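{- Let $M\subseteq A^A$ be a closed transformation monoid whose group $G$ of invertible elements is dense in $M$ and has automatic homeomorphicity, and suppose that every injective monoid endomorphism $\theta\colon M\to M$ with $\theta(g)=g$ for all $g\in G$ is the identity. Then $M$ has automatic homeomorphicity.
   Context: $A^A$ carries the topology of pointwise convergence ($A$ discrete); "closed" and "dense" refer to it. The group of invertibles of $M$ consists of $g\in M$ with some $h\in M$ such that $g\circ h=h\circ g=\mathrm{id}_A$. A closed permutation group $G$ on $A$ has automatic homeomorphicity if for every closed permutation group $G'$ on a set of the same cardinality as $A$, every group isomorphism $G\to G'$ is a homeomorphism; a closed transformation monoid $M$ on $A$ has automatic homeomorphicity if for every closed transformation monoid $M'$ on a set of the same cardinality as $A$, every monoid isomorphism $M\to M'$ is a homeomorphism. -}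

module Defs where

open import Level using (0ℓ)
open import Data.Product using (Σ; ∃; ∃-syntax; _×_; _,_; proj₁; proj₂)
open import Data.List using (List)
open import Data.List.Relation.Unary.All using (All)
open import Relation.Binary.PropositionalEquality using (_≡_)
open import Relation.Unary using (Pred)
open import Function using (_∘_; id)
open import Function.Bundles using (_↔_)

Tr : Set → Set
Tr A = A → A

_≈_ : {A : Set} → Tr A → Tr A → Set
f ≈ g = ∀ a → f a ≡ g a
infix 4 _≈_

SubsetTr : Set → Set₁
SubsetTr A = Pred (Tr A) 0ℓ

-- f and g agree on the finite set F ⊆ A.  The sets
-- { g | AgreeOn F f g } (F finite) form a neighbourhood base of f
-- in the topology of pointwise convergence (A discrete).
AgreeOn : {A : Set} → List A → Tr A → Tr A → Set
AgreeOn F f g = All (λ a → f a ≡ g a) F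

El : {A : Set} → SubsetTr A → Set
El {A} M = Σ (Tr A) M

⌊_⌋ : {A : Set} {M : SubsetTr A} → El M → Tr A
⌊ x ⌋ = proj₁ x

InClosure : {A : Set} → SubsetTr A → Tr A → Set
InClosure S f = ∀ F → ∃[ g ] (S g × AgreeOn F g f)

IsTransformationMonoid : {A : Set} → SubsetTr A → Set
IsTransformationMonoid M =
  M id × (∀ f g → M f → M g → M (f ∘ g))

IsClosedTransformationMonoid : {A : Set} → SubsetTr A → Set
IsClosedTransformationMonoid M =
  IsTransformationMonoid M × (∀ f → InClosure M f → M f)

IsPerm : {A : Set} → Tr A → Set
IsPerm {A} f = ∃[ h ] ((f ∘ h ≈ id) × (h ∘ f ≈ id))

IsPermGroup : {A : Set} → SubsetTr A → Set
IsPermGroup {A} G =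
  G id × (∀ f g → G f → G g → G (f ∘ g))
       × (∀ g → G g → ∃[ h ] (G h × (g ∘ h ≈ id) × (h ∘ g ≈ id)))

-- Closed permutation group: permutation group closed in Sym(A)
-- (with the subspace topology of pointwise convergence).
IsClosedPermGroup : {A : Set} → SubsetTr A → Set
IsClosedPermGroup G =
  IsPermGroup G × (∀ f → IsPerm f → InClosure G f → G f)

Invertibles : {A : Set} → SubsetTr A → SubsetTr A
Invertibles M g = M g × ∃[ h ] (M h × (g ∘ h ≈ id) × (h ∘ g ≈ id))

record IsMonoidHom {A B : Set} (M : SubsetTr A) (N : SubsetTr B)
                   (φ : El M → El N) : Set where
  field
    resp   : ∀ x y → ⌊ x ⌋ ≈ ⌊ y ⌋ → ⌊ φ x ⌋ ≈ ⌊ φ y ⌋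
    pres-id : ∀ x → ⌊ x ⌋ ≈ id → ⌊ φ x ⌋ ≈ id
    pres-∘ : ∀ x y z → ⌊ z ⌋ ≈ ⌊ x ⌋ ∘ ⌊ y ⌋ → ⌊ φ z ⌋ ≈ ⌊ φ x ⌋ ∘ ⌊ φ y ⌋

IsInjective : {A B : Set} {M : SubsetTr A} {N : SubsetTr B} → (El M → El N) → Set
IsInjective φ = ∀ x y → ⌊ φ x ⌋ ≈ ⌊ φ y ⌋ → ⌊ x ⌋ ≈ ⌊ y ⌋

IsSurjective : {A B : Set} {M : SubsetTr A} {N : SubsetTr B} → (El M → El N) → Set
IsSurjective {N = N} φ = ∀ (y : El N) → ∃[ x ] (⌊ φ x ⌋ ≈ ⌊ y ⌋)

-- Monoid isomorphism (for subgroups of Sym(A) this is exactly a group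
-- isomorphism).
IsMonoidIso : {A B : Set} (M : SubsetTr A) (N : SubsetTr B) → (El M → El N) → Set
IsMonoidIso M N φ = IsMonoidHom M N φ × IsInjective φ × IsSurjective φ

IsContinuous : {A B : Set} {M : SubsetTr A} {N : SubsetTr B} → (El M → El N) → Set
IsContinuous {A} {B} {M} φ =
  ∀ (x : El M) (F' : List B) → ∃[ F ] (∀ (y : El M) →
     AgreeOn F ⌊ x ⌋ ⌊ y ⌋ → AgreeOn F' ⌊ φ x ⌋ ⌊ φ y ⌋)

-- Continuity of the inverse of a bijection φ (at every point φ x of N).
IsInverseContinuous : {A B : Set} {M : SubsetTr A} {N : SubsetTr B} → (El M → El N) → Set
IsInverseContinuous {A} {B} {M} φ =
  ∀ (x : El M) (F : List A) → ∃[ F' ] (∀ (y : El M) →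
     AgreeOn F' ⌊ φ x ⌋ ⌊ φ y ⌋ → AgreeOn F ⌊ x ⌋ ⌊ y ⌋)

IsHomeomorphism : {A B : Set} {M : SubsetTr A} {N : SubsetTr B} → (El M → El N) → Set
IsHomeomorphism φ = IsContinuous φ × IsInverseContinuous φ

GroupAutoHomeo : {A : Set} → SubsetTr A → Set₁
GroupAutoHomeo {A} G =
  ∀ (B : Set) → A ↔ B → (G' : SubsetTr B) → IsClosedPermGroup G' →
  (φ : El G → El G') → IsMonoidIso G G' φ → IsHomeomorphism φ

MonoidAutoHomeo : {A : Set} → SubsetTr A → Set₁
MonoidAutoHomeo {A} M =
  ∀ (B : Set) → A ↔ B → (M' : SubsetTr B) → IsClosedTransformationMonoid M' →
  (φ : El M → El M') → IsMonoidIso M M' φ → IsHomeomorphism φ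

DenseIn : {A : Set} → SubsetTr A → SubsetTr A → Set
DenseIn {A} S M = ∀ f → M f → InClosure S f

module Submission where

--  1. The invertibles of a closed transformation monoid form a closed
--     permutation group, and φ restricts to a group isomorphism ψ between the
--     invertibles G of M and G' of M'; by hypothesis ψ is a homeomorphism.
--  2. A homomorphism of permutation groups that is (inverse-)continuous at
--     the identity is uniformly (inverse-)continuous: left translation moves
--     neighbourhoods of the identity to neighbourhoods of any point.
--  3. A uniformly continuous homomorphism on a dense submonoid G of M extends
--     to a uniformly continuous homomorphism Φ : M → M' (M' closed), and Φ
--     inherits uniform inverse continuity from ψ.
--  4. θ = φ⁻¹ ∘ Φ is then an injective endomorphism of M fixing G pointwise,
--     hence the identity by hypothesis, i.e. Φ = φ.
--  5. So φ is uniformly continuous with uniformly continuous inverse.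

open import Defs
open import Data.Product using (∃-syntax; _×_; _,_; proj₁; proj₂)
open import Data.List using (List; []; _∷_; _++_; map; concatMap)
open import Data.List.Relation.Unary.All using (All; []; _∷_; head; zipWith)
  renaming (map to mapAll)
open import Data.List.Relation.Unary.All.Properties using (++⁻ˡ; ++⁻ʳ; map⁻)
open import Relation.Binary.PropositionalEquality
  using (_≡_; refl; sym; trans; cong; module ≡-Reasoning)
open import Function using (_∘_; id)

agree-sym : {A : Set} {F : List A} {f g : Tr A} → AgreeOn F f g → AgreeOn F g f
agree-sym = mapAll sym

agree-trans : {A : Set} {F : List A} {f g h : Tr A} →
  AgreeOn F f g → AgreeOn F g h → AgreeOn F f h
agree-trans p q = zipWith (λ (f≈g , g≈h) → trans f≈g g≈h) (p , q)

agree-everywhere : {A : Set} {f g : Tr A} → f ≈ g → ∀ F → AgreeOn F f g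
agree-everywhere e [] = []
agree-everywhere e (a ∷ F) = e a ∷ agree-everywhere e F

-- Uniform continuity: the neighbourhood of a point needed to control the image does not depend
-- on the point.  These are the properties that survive extension by density.

module _ {A B : Set} {M : SubsetTr A} {N : SubsetTr B} where

  UniformlyContinuous : (El M → El N) → Set
  UniformlyContinuous φ = ∀ (F' : List B) → ∃[ F ] (∀ (x y : El M) →
    AgreeOn F ⌊ x ⌋ ⌊ y ⌋ → AgreeOn F' ⌊ φ x ⌋ ⌊ φ y ⌋)

  UniformlyInverseContinuous : (El M → El N) → Set
  UniformlyInverseContinuous φ = ∀ (F : List A) → ∃[ F' ] (∀ (x y : El M) →
    AgreeOn F' ⌊ φ x ⌋ ⌊ φ y ⌋ → AgreeOn F ⌊ x ⌋ ⌊ y ⌋)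

  uniform⇒homeomorphism : ∀ {φ : El M → El N} →
    UniformlyContinuous φ → UniformlyInverseContinuous φ → IsHomeomorphism φ
  uniform⇒homeomorphism uc uic =
    (λ x F' → proj₁ (uc F') , proj₂ (uc F') x) ,
    (λ x F → proj₁ (uic F) , proj₂ (uic F) x)

  -- Injectivity is uniform inverse continuity on singletons.
  uniformlyInverseContinuous⇒injective : ∀ {φ : El M → El N} →
    UniformlyInverseContinuous φ → IsInjective {M = M} {N = N} φ
  uniformlyInverseContinuous⇒injective uic x y e a =
    head (proj₂ (uic (a ∷ [])) x y (agree-everywhere e _))

  module _ {φ Φ : El M → El N} (φ≈Φ : ∀ x → ⌊ φ x ⌋ ≈ ⌊ Φ x ⌋) where

    uniformlyContinuous-cong :
      UniformlyContinuous Φ → UniformlyContinuous φ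
    uniformlyContinuous-cong uc F' = proj₁ (uc F') , λ x y ag →
      mapAll (λ {b} p → trans (φ≈Φ x b) (trans p (sym (φ≈Φ y b))))
             (proj₂ (uc F') x y ag)

    uniformlyInverseContinuous-cong :
      UniformlyInverseContinuous Φ → UniformlyInverseContinuous φ
    uniformlyInverseContinuous-cong uic F = proj₁ (uic F) , λ x y ag →
      proj₂ (uic F) x y
        (mapAll (λ {b} p → trans (sym (φ≈Φ x b)) (trans p (φ≈Φ y b))) ag)

module MonoidHom {A B : Set} {M : SubsetTr A} {N : SubsetTr B}
  (tM : IsTransformationMonoid M)
  {φ : El M → El N} (φ-hom : IsMonoidHom M N φ) where

  open IsMonoidHom φ-hom

  unit : El M
  unit = id , proj₁ tM

  _·_ : El M → El M → El M
  x · y = ⌊ x ⌋ ∘ ⌊ y ⌋ , proj₂ tM ⌊ x ⌋ ⌊ y ⌋ (proj₂ x) (proj₂ y)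

  map-unit : ⌊ φ unit ⌋ ≈ id
  map-unit = pres-id unit (λ _ → refl)

  map-· : ∀ x y → ⌊ φ (x · y) ⌋ ≈ ⌊ φ x ⌋ ∘ ⌊ φ y ⌋
  map-· x y = pres-∘ x y (x · y) (λ _ → refl)

  map-inverse-pair : ∀ x y → ⌊ x ⌋ ∘ ⌊ y ⌋ ≈ id → ⌊ φ x ⌋ ∘ ⌊ φ y ⌋ ≈ id
  map-inverse-pair x y e b =
    trans (sym (pres-∘ x y unit (λ a → sym (e a)) b)) (map-unit b)

  reflect-inverse-pair : IsInjective {M = M} {N = N} φ →
    ∀ x y → ⌊ φ x ⌋ ∘ ⌊ φ y ⌋ ≈ id → ⌊ x ⌋ ∘ ⌊ y ⌋ ≈ id
  reflect-inverse-pair inj x y e =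
    inj (x · y) unit (λ b → trans (map-· x y b) (trans (e b) (sym (map-unit b))))

module Invertibility {A : Set} {N : SubsetTr A} (tN : IsTransformationMonoid N) where

  invertible-id : Invertibles N id
  invertible-id = proj₁ tN , id , proj₁ tN , (λ _ → refl) , (λ _ → refl)

  invertible-∘ : ∀ {f g} → Invertibles N f → Invertibles N g → Invertibles N (f ∘ g)
  invertible-∘ {f} {g} (Nf , f' , Nf' , ff'≈id , f'f≈id) (Ng , g' , Ng' , gg'≈id , g'g≈id) =
    proj₂ tN f g Nf Ng , g' ∘ f' , proj₂ tN g' f' Ng' Nf' ,
    (λ a → trans (cong f (gg'≈id (f' a))) (ff'≈id a)) ,
    (λ a → trans (cong g' (f'f≈id (g a))) (g'g≈id a))

  invertible-inverse : ∀ {g} (p : Invertibles N g) → Invertibles N (proj₁ (proj₂ p))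
  invertible-inverse {g} (Ng , h , Nh , gh≈id , hg≈id) = Nh , g , Ng , hg≈id , gh≈id

  invertibles-permGroup : IsPermGroup (Invertibles N)
  invertibles-permGroup =
    invertible-id , (λ _ _ → invertible-∘) ,
    λ g p → proj₁ (proj₂ p) , invertible-inverse p , proj₂ (proj₂ (proj₂ p))

permGroup⇒monoid : {A : Set} {G : SubsetTr A} → IsPermGroup G → IsTransformationMonoid G
permGroup⇒monoid (G-id , G-∘ , _) = G-id , G-∘

-- In a closed monoid the inverse of a permutation in the closure of the
-- invertibles is a limit of their inverses, so both lie in the monoid.
invertibles-closedPermGroup : {A : Set} {N : SubsetTr A} →
  IsClosedTransformationMonoid N → IsClosedPermGroup (Invertibles N)
invertibles-closedPermGroup {N = N} (tN , closedN) =
  invertibles-permGroup , λ f → closure-invertible f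
  where
  open Invertibility tN

  closure-invertible : ∀ f → IsPerm f → InClosure (Invertibles N) f → Invertibles N f
  closure-invertible f (k , fk≈id , kf≈id) cl = N-f , k , N-k , fk≈id , kf≈id
    where
    N-f : N f
    N-f = closedN f (λ F → proj₁ (cl F) , proj₁ (proj₁ (proj₂ (cl F))) , proj₂ (proj₂ (cl F)))

    -- if g agrees with f on k[F] then its inverse g' agrees with k on F
    k-in-closure : InClosure N k
    k-in-closure F with cl (map k F)
    ... | g , (_ , g' , N-g' , _ , g'g≈id) , g≈f =
      g' , N-g' , mapAll (λ {b} g≈f-at → begin
          g' b           ≡⟨ cong g' (sym (fk≈id b)) ⟩
          g' (f (k b))   ≡⟨ cong g' (sym g≈f-at) ⟩
          g' (g (k b))   ≡⟨ g'g≈id (k b) ⟩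
          k b            ∎) (map⁻ g≈f)
      where open ≡-Reasoning

    N-k : N k
    N-k = closedN k k-in-closure

forget : {B : Set} {N : SubsetTr B} → El (Invertibles N) → El N
forget y = ⌊ y ⌋ , proj₁ (proj₂ y)

forget-hom : {A B : Set} {M : SubsetTr A} {N : SubsetTr B}
  {φ : El M → El (Invertibles N)} →
  IsMonoidHom M (Invertibles N) φ → IsMonoidHom M N (forget ∘ φ)
forget-hom φ-hom = record { resp = resp ; pres-id = pres-id ; pres-∘ = pres-∘ }
  where open IsMonoidHom φ-hom

module Restriction {A B : Set} {M : SubsetTr A} {M' : SubsetTr B}
  (tM : IsTransformationMonoid M)
  {φ : El M → El M'} (φ-iso : IsMonoidIso M M' φ) where

  open IsMonoidHom (proj₁ φ-iso)
  open MonoidHom tM (proj₁ φ-iso)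

  φ-injective : IsInjective {M = M} {N = M'} φ
  φ-injective = proj₁ (proj₂ φ-iso)

  φ-surjective : IsSurjective {M = M} {N = M'} φ
  φ-surjective = proj₂ (proj₂ φ-iso)

  restrict : El (Invertibles M) → El (Invertibles M')
  restrict (f , M-f , f' , M-f' , ff'≈id , f'f≈id) =
    ⌊ φ x ⌋ , proj₂ (φ x) , ⌊ φ x' ⌋ , proj₂ (φ x') ,
    map-inverse-pair x x' ff'≈id , map-inverse-pair x' x f'f≈id
    where
    x x' : El M
    x = f , M-f
    x' = f' , M-f'

  restrict-hom : IsMonoidHom (Invertibles M) (Invertibles M') restrict
  restrict-hom = record
    { resp = λ x y → resp (forget x) (forget y)
    ; pres-id = λ x → pres-id (forget x)
    ; pres-∘ = λ x y z → pres-∘ (forget x) (forget y) (forget z)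
    }

  -- the preimages of an invertible and of its inverse are mutually inverse
  restrict-surjective : IsSurjective {M = Invertibles M} {N = Invertibles M'} restrict
  restrict-surjective (k , M'-k , k' , M'-k' , kk'≈id , k'k≈id) =
    (⌊ x ⌋ , proj₂ x , ⌊ x' ⌋ , proj₂ x' ,
       reflect-inverse-pair φ-injective x x' (transport x x' φx≈k φx'≈k' kk'≈id) ,
       reflect-inverse-pair φ-injective x' x (transport x' x φx'≈k' φx≈k k'k≈id)) ,
    φx≈k
    where
    x = proj₁ (φ-surjective (k , M'-k))
    x' = proj₁ (φ-surjective (k' , M'-k'))
    φx≈k = proj₂ (φ-surjective (k , M'-k))
    φx'≈k' = proj₂ (φ-surjective (k' , M'-k'))

    transport : ∀ u v {h h'} → ⌊ φ u ⌋ ≈ h → ⌊ φ v ⌋ ≈ h' → h ∘ h' ≈ id →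
                ⌊ φ u ⌋ ∘ ⌊ φ v ⌋ ≈ id
    transport u v {h' = h'} φu≈h φv≈h' hh'≈id b =
      trans (cong ⌊ φ u ⌋ (φv≈h' b)) (trans (φu≈h (h' b)) (hh'≈id b))

  restrict-agrees : ∀ x (G-x : Invertibles M ⌊ x ⌋) → ⌊ restrict (⌊ x ⌋ , G-x) ⌋ ≈ ⌊ φ x ⌋
  restrict-agrees x G-x = resp (forget (⌊ x ⌋ , G-x)) x (λ _ → refl)

  restrict-iso : IsMonoidIso (Invertibles M) (Invertibles M') restrict
  restrict-iso =
    restrict-hom ,
    (λ x y → φ-injective (forget x) (forget y)) ,
    restrict-surjective

-- A homomorphism of permutation groups that is continuous at the identity is
-- uniformly continuous: g and h agree on F iff h⁻¹g agrees with id on F.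

module GroupUniformity {A B : Set} {G : SubsetTr A} {N : SubsetTr B}
  (pg : IsPermGroup G)
  {ψ : El G → El N} (ψ-hom : IsMonoidHom G N ψ) where

  open MonoidHom (permGroup⇒monoid pg) ψ-hom

  inverse-of : ∀ (h : El G) → ∃[ k ] (G k × (⌊ h ⌋ ∘ k ≈ id) × (k ∘ ⌊ h ⌋ ≈ id))
  inverse-of h = proj₂ (proj₂ pg) ⌊ h ⌋ (proj₂ h)

  _⁻¹ : El G → El G
  h ⁻¹ = proj₁ (inverse-of h) , proj₁ (proj₂ (inverse-of h))

  inverseʳ : ∀ h → ⌊ h ⌋ ∘ ⌊ h ⁻¹ ⌋ ≈ id
  inverseʳ h = proj₁ (proj₂ (proj₂ (inverse-of h)))

  inverseˡ : ∀ h → ⌊ h ⁻¹ ⌋ ∘ ⌊ h ⌋ ≈ id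
  inverseˡ h = proj₂ (proj₂ (proj₂ (inverse-of h)))

  quotient : El G → El G → El G
  quotient g h = (h ⁻¹) · g

  quotient-near-unit : ∀ F g h → AgreeOn F ⌊ g ⌋ ⌊ h ⌋ → AgreeOn F id ⌊ quotient g h ⌋
  quotient-near-unit F g h =
    mapAll (λ {a} g≈h → sym (trans (cong ⌊ h ⁻¹ ⌋ g≈h) (inverseˡ h a)))

  near-unit-quotient : ∀ F g h → AgreeOn F id ⌊ quotient g h ⌋ → AgreeOn F ⌊ g ⌋ ⌊ h ⌋
  near-unit-quotient F g h =
    mapAll (λ {a} a≈q → trans (sym (inverseʳ h (⌊ g ⌋ a))) (cong ⌊ h ⌋ (sym a≈q)))

  continuous⇒uniformlyContinuous :
    IsContinuous {M = G} {N = N} ψ → UniformlyContinuous {M = G} {N = N} ψ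
  continuous⇒uniformlyContinuous cont F' = F , close
    where
    open ≡-Reasoning
    F = proj₁ (cont unit F')

    close : ∀ g h → AgreeOn F ⌊ g ⌋ ⌊ h ⌋ → AgreeOn F' ⌊ ψ g ⌋ ⌊ ψ h ⌋
    close g h g≈h = mapAll (λ {b} unit≈q → begin
      ⌊ ψ g ⌋ b                         ≡⟨ sym (map-inverse-pair h (h ⁻¹) (inverseʳ h) (⌊ ψ g ⌋ b)) ⟩
      ⌊ ψ h ⌋ (⌊ ψ (h ⁻¹) ⌋ (⌊ ψ g ⌋ b)) ≡⟨ cong ⌊ ψ h ⌋ (sym (map-· (h ⁻¹) g b)) ⟩
      ⌊ ψ h ⌋ (⌊ ψ (quotient g h) ⌋ b)  ≡⟨ cong ⌊ ψ h ⌋ (sym unit≈q) ⟩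
      ⌊ ψ h ⌋ (⌊ ψ unit ⌋ b)            ≡⟨ cong ⌊ ψ h ⌋ (map-unit b) ⟩
      ⌊ ψ h ⌋ b                         ∎)
      (proj₂ (cont unit F') (quotient g h) (quotient-near-unit F g h g≈h))

  inverseContinuous⇒uniformlyInverseContinuous :
    IsInverseContinuous {M = G} {N = N} ψ → UniformlyInverseContinuous {M = G} {N = N} ψ
  inverseContinuous⇒uniformlyInverseContinuous icont F = F' , λ g h ψg≈ψh →
    near-unit-quotient F g h
      (proj₂ (icont unit F) (quotient g h)
        (mapAll (λ {b} ψg≈ψh-at → begin
          ⌊ ψ unit ⌋ b                      ≡⟨ map-unit b ⟩
          b                                 ≡⟨ sym (map-inverse-pair (h ⁻¹) h (inverseˡ h) b) ⟩
          ⌊ ψ (h ⁻¹) ⌋ (⌊ ψ h ⌋ b)          ≡⟨ cong ⌊ ψ (h ⁻¹) ⌋ (sym ψg≈ψh-at) ⟩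
          ⌊ ψ (h ⁻¹) ⌋ (⌊ ψ g ⌋ b)          ≡⟨ sym (map-· (h ⁻¹) g b) ⟩
          ⌊ ψ (quotient g h) ⌋ b            ∎) ψg≈ψh))
    where
    open ≡-Reasoning
    F' = proj₁ (icont unit F)

-- At b ∈ B,
-- Φ(f)(b) = ψ(g)(b) for any g ∈ G close enough to f; uniform continuity makes
-- this independent of the choice of g.

module Extension {A B : Set} {M G : SubsetTr A} {M' : SubsetTr B}
  (tG : IsTransformationMonoid G) (dense : DenseIn G M)
  (closedM' : ∀ f → InClosure M' f → M' f)
  (ψ : El G → El M') (ψ-hom : IsMonoidHom G M' ψ)
  (ψ-uc : UniformlyContinuous {M = G} {N = M'} ψ) where

  open MonoidHom tG ψ-hom

  approx : El M → List A → El G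
  approx f F = proj₁ (dense ⌊ f ⌋ (proj₂ f) F) , proj₁ (proj₂ (dense ⌊ f ⌋ (proj₂ f) F))

  approx-agrees : ∀ f F → AgreeOn F ⌊ approx f F ⌋ ⌊ f ⌋
  approx-agrees f F = proj₂ (proj₂ (dense ⌊ f ⌋ (proj₂ f) F))

  -- agreement on modulus b determines the value of ψ at b
  modulus : B → List A
  modulus b = proj₁ (ψ-uc (b ∷ []))

  moduli : List B → List A
  moduli = concatMap modulus

  extend : El M → Tr B
  extend f b = ⌊ ψ (approx f (modulus b)) ⌋ b

  extend-spec : ∀ f b g → AgreeOn (modulus b) ⌊ g ⌋ ⌊ f ⌋ → ⌊ ψ g ⌋ b ≡ extend f b
  extend-spec f b g g≈f = head (proj₂ (ψ-uc (b ∷ [])) g (approx f (modulus b))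
    (agree-trans g≈f (agree-sym (approx-agrees f (modulus b)))))

  extend-spec-list : ∀ f F' g → AgreeOn (moduli F') ⌊ g ⌋ ⌊ f ⌋ → AgreeOn F' ⌊ ψ g ⌋ (extend f)
  extend-spec-list f [] g g≈f = []
  extend-spec-list f (b ∷ F') g g≈f =
    extend-spec f b g (++⁻ˡ (modulus b) g≈f) ∷ extend-spec-list f F' g (++⁻ʳ (modulus b) g≈f)

  -- extend f is a limit of elements of ψ[G] ⊆ M', hence lies in M'
  extension : El M → El M'
  extension f = extend f , closedM' (extend f) (λ F' →
    ⌊ ψ (approx f (moduli F')) ⌋ , proj₂ (ψ (approx f (moduli F'))) ,
    extend-spec-list f F' (approx f (moduli F')) (approx-agrees f (moduli F')))

  extension-extends : ∀ x (G-x : G ⌊ x ⌋) → ⌊ extension x ⌋ ≈ ⌊ ψ (⌊ x ⌋ , G-x) ⌋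
  extension-extends x G-x b = sym (extend-spec x b (⌊ x ⌋ , G-x) (agree-everywhere (λ _ → refl) _))

  -- Φ(xy) = Φ(x)Φ(y): approximate y by u near the modulus at b and x by v near
  -- the modulus at Φ(y)(b) and near y[modulus b]; then vu approximates xy.
  extension-∘ : ∀ x y z → ⌊ z ⌋ ≈ ⌊ x ⌋ ∘ ⌊ y ⌋ → extend z ≈ extend x ∘ extend y
  extension-∘ x y z z≈xy b = begin
    extend z b                  ≡⟨ sym (extend-spec z b (v · u) vu≈z) ⟩
    ⌊ ψ (v · u) ⌋ b             ≡⟨ map-· v u b ⟩
    ⌊ ψ v ⌋ (extend y b)        ≡⟨ extend-spec x (extend y b) v (++⁻ˡ (modulus (extend y b)) v≈x) ⟩
    extend x (extend y b)       ∎
    where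
    open ≡-Reasoning
    u = approx y (modulus b)
    L = modulus (extend y b) ++ map ⌊ y ⌋ (modulus b)
    v = approx x L
    v≈x = approx-agrees x L
    vu≈z : AgreeOn (modulus b) ⌊ v · u ⌋ ⌊ z ⌋
    vu≈z = composite-agrees (approx-agrees y (modulus b))
                            (map⁻ (++⁻ʳ (modulus (extend y b)) v≈x))
      where
      composite-agrees : ∀ {F} → AgreeOn F ⌊ u ⌋ ⌊ y ⌋ →
        All (λ a → ⌊ v ⌋ (⌊ y ⌋ a) ≡ ⌊ x ⌋ (⌊ y ⌋ a)) F → AgreeOn F ⌊ v · u ⌋ ⌊ z ⌋
      composite-agrees [] [] = []
      composite-agrees {a ∷ _} (u≈y ∷ ps) (vy≈xy ∷ qs) =
        trans (cong ⌊ v ⌋ u≈y) (trans vy≈xy (sym (z≈xy a))) ∷ composite-agrees ps qs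

  extension-hom : IsMonoidHom M M' extension
  extension-hom = record
    { resp = λ x y x≈y b → extend-spec y b (approx x (modulus b))
        (mapAll (λ {a} p → trans p (x≈y a)) (approx-agrees x (modulus b)))
    ; pres-id = λ x x≈id b → trans
        (sym (extend-spec x b unit (agree-everywhere (λ a → sym (x≈id a)) _))) (map-unit b)
    ; pres-∘ = extension-∘
    }

  -- x and y close ⇒ a common approximant g ⇒ extend x, ψ g, extend y close
  extension-uniformlyContinuous : UniformlyContinuous {M = M} {N = M'} extension
  extension-uniformlyContinuous F' = moduli F' , λ x y x≈y →
    let g = approx x (moduli F')
        g≈x = approx-agrees x (moduli F')
    in agree-trans (agree-sym (extend-spec-list x F' g g≈x))
                   (extend-spec-list y F' g (agree-trans g≈x x≈y))

  -- approximants g of x and h of y: extend x ≈ extend y ⇒ ψ g ≈ ψ h ⇒ g ≈ h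
  extension-uniformlyInverseContinuous :
    UniformlyInverseContinuous {M = G} {N = M'} ψ →
    UniformlyInverseContinuous {M = M} {N = M'} extension
  extension-uniformlyInverseContinuous ψ-uic F = F' , close
    where
    F' = proj₁ (ψ-uic F)
    L = F ++ moduli F'

    close : ∀ x y → AgreeOn F' (extend x) (extend y) → AgreeOn F ⌊ x ⌋ ⌊ y ⌋
    close x y Φx≈Φy = agree-trans (agree-sym (++⁻ˡ F g≈x))
                        (agree-trans (proj₂ (ψ-uic F) g h ψg≈ψh) (++⁻ˡ F h≈y))
      where
      g = approx x L
      h = approx y L
      g≈x = approx-agrees x L
      h≈y = approx-agrees y L
      ψg≈ψh : AgreeOn F' ⌊ ψ g ⌋ ⌊ ψ h ⌋
      ψg≈ψh = agree-trans (extend-spec-list x F' g (++⁻ʳ F g≈x))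
                (agree-trans Φx≈Φy (agree-sym (extend-spec-list y F' h (++⁻ʳ F h≈y))))

-- Pulling a homomorphism Φ : M → M' back along an isomorphism φ : M ≅ M'
-- gives an endomorphism θ = φ⁻¹ ∘ Φ of M, which fixes x iff Φ x = φ x.

module Pullback {A B : Set} {M : SubsetTr A} {M' : SubsetTr B}
  (tM : IsTransformationMonoid M)
  {φ : El M → El M'} (φ-iso : IsMonoidIso M M' φ)
  {Φ : El M → El M'} (Φ-hom : IsMonoidHom M M' Φ) where

  open MonoidHom tM (proj₁ φ-iso)
  open IsMonoidHom (proj₁ φ-iso) using () renaming (resp to φ-resp)
  open IsMonoidHom Φ-hom using ()
    renaming (resp to Φ-resp; pres-id to Φ-pres-id; pres-∘ to Φ-pres-∘)

  φ-injective : IsInjective {M = M} {N = M'} φ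
  φ-injective = proj₁ (proj₂ φ-iso)

  θ : El M → El M
  θ x = proj₁ (proj₂ (proj₂ φ-iso) (Φ x))

  φθ≈Φ : ∀ x → ⌊ φ (θ x) ⌋ ≈ ⌊ Φ x ⌋
  φθ≈Φ x = proj₂ (proj₂ (proj₂ φ-iso) (Φ x))

  θ-∘ : ∀ x y z → ⌊ z ⌋ ≈ ⌊ x ⌋ ∘ ⌊ y ⌋ → ⌊ θ z ⌋ ≈ ⌊ θ x ⌋ ∘ ⌊ θ y ⌋
  θ-∘ x y z z≈xy = φ-injective (θ z) (θ x · θ y) λ b → begin
    ⌊ φ (θ z) ⌋ b                     ≡⟨ φθ≈Φ z b ⟩
    ⌊ Φ z ⌋ b                         ≡⟨ Φ-pres-∘ x y z z≈xy b ⟩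
    ⌊ Φ x ⌋ (⌊ Φ y ⌋ b)               ≡⟨ cong ⌊ Φ x ⌋ (sym (φθ≈Φ y b)) ⟩
    ⌊ Φ x ⌋ (⌊ φ (θ y) ⌋ b)           ≡⟨ sym (φθ≈Φ x _) ⟩
    ⌊ φ (θ x) ⌋ (⌊ φ (θ y) ⌋ b)       ≡⟨ sym (map-· (θ x) (θ y) b) ⟩
    ⌊ φ (θ x · θ y) ⌋ b               ∎
    where open ≡-Reasoning

  θ-hom : IsMonoidHom M M θ
  θ-hom = record
    { resp = λ x y x≈y → φ-injective (θ x) (θ y) λ b →
        trans (φθ≈Φ x b) (trans (Φ-resp x y x≈y b) (sym (φθ≈Φ y b)))
    ; pres-id = λ x x≈id → φ-injective (θ x) unit λ b →
        trans (φθ≈Φ x b) (trans (Φ-pres-id x x≈id b) (sym (map-unit b)))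
    ; pres-∘ = θ-∘
    }

  θ-injective : IsInjective {M = M} {N = M'} Φ → IsInjective {M = M} {N = M} θ
  θ-injective Φ-injective x y θx≈θy = Φ-injective x y λ b →
    trans (sym (φθ≈Φ x b)) (trans (φ-resp (θ x) (θ y) θx≈θy b) (φθ≈Φ y b))

  θ-fixes : ∀ x → ⌊ Φ x ⌋ ≈ ⌊ φ x ⌋ → ⌊ θ x ⌋ ≈ ⌊ x ⌋
  θ-fixes x Φx≈φx = φ-injective (θ x) x λ b → trans (φθ≈Φ x b) (Φx≈φx b)

  θ-fixed⇒agree : ∀ x → ⌊ θ x ⌋ ≈ ⌊ x ⌋ → ⌊ φ x ⌋ ≈ ⌊ Φ x ⌋
  θ-fixed⇒agree x θx≈x b = trans (sym (φ-resp (θ x) x θx≈x b)) (φθ≈Φ x b)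

corollary3p6 : (A : Set) (M : SubsetTr A) →
    IsClosedTransformationMonoid M →
    DenseIn (Invertibles M) M →
    GroupAutoHomeo (Invertibles M) →
    ((θ : El M → El M) → IsMonoidHom M M θ → IsInjective {M = M} {N = M} θ →
    (∀ x → Invertibles M ⌊ x ⌋ → ⌊ θ x ⌋ ≈ ⌊ x ⌋) →
    ∀ x → ⌊ θ x ⌋ ≈ ⌊ x ⌋) →
    MonoidAutoHomeo M
corollary3p6 A M (tM , _) dense G-autoHomeo rigid B A↔B M' cM' φ φ-iso =
  uniform⇒homeomorphism {φ = φ}
    (uniformlyContinuous-cong {φ = φ} {Φ = extension} φ≈Φ extension-uniformlyContinuous)
    (uniformlyInverseContinuous-cong {φ = φ} {Φ = extension} φ≈Φ Φ-uic)
  where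
  G-permGroup = Invertibility.invertibles-permGroup tM
  open Restriction tM φ-iso
  open GroupUniformity G-permGroup restrict-hom

  ψ-homeo : IsHomeomorphism {M = Invertibles M} {N = Invertibles M'} restrict
  ψ-homeo = G-autoHomeo B A↔B (Invertibles M') (invertibles-closedPermGroup cM')
                        restrict restrict-iso

  open Extension (permGroup⇒monoid G-permGroup) dense (proj₂ cM')
    (forget ∘ restrict) (forget-hom restrict-hom)
    (continuous⇒uniformlyContinuous (proj₁ ψ-homeo))

  Φ-uic : UniformlyInverseContinuous {M = M} {N = M'} extension
  Φ-uic = extension-uniformlyInverseContinuous
            (inverseContinuous⇒uniformlyInverseContinuous (proj₂ ψ-homeo))

  open Pullback tM φ-iso extension-hom

  -- θ = φ⁻¹ ∘ Φ fixes the invertibles, since Φ extends ψ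
  θ-fixes-invertibles : ∀ x → Invertibles M ⌊ x ⌋ → ⌊ θ x ⌋ ≈ ⌊ x ⌋
  θ-fixes-invertibles x G-x =
    θ-fixes x (λ b → trans (extension-extends x G-x b) (restrict-agrees x G-x b))

  φ≈Φ : ∀ x → ⌊ φ x ⌋ ≈ ⌊ extension x ⌋
  φ≈Φ x = θ-fixed⇒agree x (rigid θ θ-hom
    (θ-injective (uniformlyInverseContinuous⇒injective {φ = extension} Φ-uic)) θ-fixes-invertibles x)
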